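{- Let $f:\{0,1\}^n\to\{0,1\}$ be given by a compact form DNF representation of width $d_\wedge$ with the block property. Then $\mathrm{s}(f)\ge\left\lceil\frac{d_\wedge}{2}\right\rceil$.
   Context: For $x\in\{0,1\}^n$, $x^i$ flips bit $i$ and $x^B$ flips bits in $B\subseteq[n]$. $\mathrm{s}(f,x)=|\{i: f(x)\neq f(x^i)\}|$, $\mathrm{s}(f)=\max_x\mathrm{s}(f,x)$. $\mathrm{bs}(f,x)$ is the maximum number of pairwise disjoint $B\subseteq[n]$ with $f(x^B)\ne f(x)$; $\mathrm{bs}_0(f)=\max_{f(x)=0}\mathrm{bs}(f,x)$. A DNF representation is an OR of terms $\wedge_1,\dots,\wedge_{d_\vee}$, each an AND of literals, no term containing a variable and its negation; $A_i$ (resp. $\overline{A}_i$) is the set of variables unnegated (resp. negated) in $\wedge_i$; width $d_\wedge=\max_i(|A_i|+|\overline{A}_i|)$; $S_i$ is the set of assignments satisfying $\wedge_i$. Compact form: (a) $f(0^n)=0$, (b) $\mathrm{bs}_0(f)=\mathrm{bs}(f,0^n)$, (c) $S_i\setminus\bigcup_{j\ne i}S_j\ne\emptyset$ for all $i$. Block property: $A_i\cap A_j=\emptyset$ for $i\neq j$. -}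

module Defs where

open import Data.Bool using (Bool; true; false; not; _∧_; _∨_; _xor_; if_then_else_)
open import Data.Nat using (ℕ; zero; suc; _+_; _⊔_)
open import Data.Fin using (Fin)
open import Data.Fin.Subset using (Subset; _∈_; _∩_; ∣_∣; Empty)
open import Data.Vec using (Vec; []; _∷_; replicate; zipWith; lookup; _[_]%=_)
open import Data.List using (List; []; _∷_; map; _++_; foldr; length; filter; allFin)
open import Data.Bool.ListAction using (any; all)
open import Data.List.Relation.Unary.AllPairs using (AllPairs)
open import Relation.Binary.PropositionalEquality using (_≡_; _≢_)
open import Relation.Nullary using (¬_; ¬?)
open import Data.Bool.Properties using () renaming (_≟_ to _≟B_)
open import Data.Product using (∃; _×_)
open import Relation.Nullary.Decidable using (⌊_⌋)

-- Points of the Boolean cube {0,1}^n (false = 0, true = 1).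
Point : ℕ → Set
Point n = Vec Bool n

BoolFun : ℕ → Set
BoolFun n = Point n → Bool

zeroPt : (n : ℕ) → Point n
zeroPt n = replicate n false

flip : {n : ℕ} → Point n → Fin n → Point n
flip x i = x [ i ]%= not

flipB : {n : ℕ} → Point n → Subset n → Point n
flipB x B = zipWith _xor_ x B

allPoints : (n : ℕ) → List (Point n)
allPoints zero    = [] ∷ []
allPoints (suc n) = map (false ∷_) (allPoints n) ++ map (true ∷_) (allPoints n)

maxList : List ℕ → ℕ
maxList = foldr _⊔_ 0

sensAt : {n : ℕ} → BoolFun n → Point n → ℕ
sensAt {n} f x = length (filter (λ i → ¬? (f x ≟B f (flip x i))) (allFin n))

sens : {n : ℕ} → BoolFun n → ℕ
sens {n} f = maxList (map (sensAt f) (allPoints n))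

-- "x admits k pairwise disjoint sensitive blocks", i.e. bs(f,x) ≥ k:
-- a list of k pairwise disjoint B ⊆ [n] with f(x^B) ≠ f(x).
HasSensitiveBlocks : {n : ℕ} → BoolFun n → Point n → ℕ → Set
HasSensitiveBlocks {n} f x k =
  ∃ λ (Bs : List (Subset n)) →
    length Bs ≡ k
    × AllPairs (λ B C → Empty (B ∩ C)) Bs
    × Data.List.Relation.Unary.All.All (λ B → f (flipB x B) ≢ f x) Bs
  where import Data.List.Relation.Unary.All

record Term (n : ℕ) : Set where
  constructor term
  field
    pos : Subset n
    neg : Subset n
open Term public

satTerm : {n : ℕ} → Term n → Point n → Bool
satTerm {n} t x =
  all (λ j → (not (lookup (pos t) j) ∨ lookup x j)
           ∧ (not (lookup (neg t) j) ∨ not (lookup x j))) (allFin n)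

DNF : ℕ → ℕ → Set
DNF n m = Fin m → Term n

WellFormed : {n m : ℕ} → DNF n m → Set
WellFormed D = ∀ i → Empty (pos (D i) ∩ neg (D i))

evalDNF : {n m : ℕ} → DNF n m → BoolFun n
evalDNF {m = m} D x = any (λ i → satTerm (D i) x) (allFin m)

width : {n m : ℕ} → DNF n m → ℕ
width {m = m} D = maxList (map (λ i → ∣ pos (D i) ∣ + ∣ neg (D i) ∣) (allFin m))

-- Compact form:
-- (a) f(0^n) = 0
-- (b) bs_0(f) = bs(f,0^n): every k achieved as a number of disjoint sensitive
--     blocks at some 0-input is achieved at 0^n (together with (a) this says
--     exactly max_{f(x)=0} bs(f,x) = bs(f,0^n))
-- (c) S_i \ ⋃_{j≠i} S_j ≠ ∅ for every i
record CompactForm {n m : ℕ} (D : DNF n m) : Set where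
  field
    zeroIsZero : evalDNF D (zeroPt n) ≡ false
    bs0AtZero  : ∀ (x : Point n) (k : ℕ) → evalDNF D x ≡ false →
                 HasSensitiveBlocks (evalDNF D) x k →
                 HasSensitiveBlocks (evalDNF D) (zeroPt n) k
    uniqueSat  : ∀ (i : Fin m) → ∃ λ (x : Point n) →
                 satTerm (D i) x ≡ true
                 × (∀ (j : Fin m) → j ≢ i → satTerm (D j) x ≡ false)

BlockProperty : {n m : ℕ} → DNF n m → Set
BlockProperty {m = m} D = ∀ (i j : Fin m) → i ≢ j → Empty (pos (D i) ∩ pos (D j))

-- Fix a term ∧ᵢ with positive variables A and negative variables Ā, and let y be
-- the indicator of A, which satisfies ∧ᵢ.  Flipping a variable k ∈ A falsifies f:
-- ∧ᵢ fails, and any other term satisfied there would have its positive variables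
-- inside A, hence none by the block property, so it would already be satisfied by
-- 0ⁿ.  Flipping k ∈ Ā falsifies ∧ᵢ too; if some other term ∧ⱼ is satisfied
-- instead, the same reasoning forces Aⱼ = {k}, and then ∧ⱼ is satisfied by the
-- unit vector eₖ, so 0ⁿ is sensitive at k.  Hence A ⊆ S(y) and Ā ⊆ S(y) ∪ S(0ⁿ),
-- where S(x) is the set of sensitive coordinates at x, and since A ∩ Ā = ∅ we
-- get |A| + |Ā| ≤ s(f, y) + s(f, 0ⁿ) ≤ 2 s(f).
module Submission where

open import Defs
open import Data.Nat using (ℕ; _≤_; ⌈_/2⌉)

open import Data.Bool using (true; false; not; T; T?; _∨_)
open import Data.Bool.Properties using (T-≡; T-∧; not-involutive) renaming (_≟_ to _≟B_)
open import Data.Empty using (⊥-elim)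
open import Data.Fin using (Fin; zero; suc) renaming (_≟_ to _≟F_)
open import Data.Fin.Subset
  using (Subset; inside; outside; _∈_; _∉_; _⊆_; _∪_; _∩_; ∁; ⁅_⁆; Empty; Nonempty; ∣_∣)
  renaming (⊥ to ∅)
open import Data.Fin.Subset.Properties
  using ( x∈p∩q⁺; x∈p∪q⁺; x∈p∪q⁻; x∉p⇒x∈∁p; x∈∁p⇒x∉p; ∉⊥; x∈⁅x⁆; x∈⁅y⁆⇒x≡y
        ; p⊆q⇒∣p∣≤∣q∣; Empty-unique; ∣⊥∣≡0; nonempty?)
open import Data.List using ([]; _∷_; length; filter; allFin)
import Data.List as List
open import Data.List.Membership.Propositional using (find; lose) renaming (_∈_ to _∈ˡ_)
open import Data.List.Membership.Propositional.Properties using (∈-map⁺; ∈-++⁺ˡ; ∈-++⁺ʳ; ∈-allFin)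
open import Data.List.Relation.Unary.All using (All; []; _∷_)
import Data.List.Relation.Unary.All as All
open import Data.List.Relation.Unary.All.Properties using (all⁺; all⁻; map⁺; tabulate⁺)
open import Data.List.Relation.Unary.Any using (here; there)
open import Data.List.Relation.Unary.Any.Properties using (any⁺; any⁻)
open import Data.Nat using (suc; _+_; z≤n)
open import Data.Nat.Properties
  using ( ≤-trans; m≤m⊔n; m≤n⊔m; ⊔-lub; m≤m+n; +-suc; +-identityʳ; +-mono-≤
        ; ⌈n/2⌉-mono; n≡⌈n+n/2⌉; module ≤-Reasoning)
open import Data.Product using (∃-syntax; _×_; _,_; proj₁; proj₂)
open import Data.Sum using (inj₁; inj₂)
open import Data.Vec using ([]; _∷_; lookup)
import Data.Vec as Vec
open import Data.Vec.Properties
  using ( updateAt-updates; updateAt-minimal; updateAt-updateAt; updateAt-id-local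
        ; []=-injective; []=⇒lookup; lookup⇒[]=; lookup-map; lookup∘tabulate)
open import Function using (id; _∘_; _⇔_; mk⇔; Equivalence)
open import Relation.Binary.PropositionalEquality
  using (_≡_; _≢_; refl; sym; trans; cong; cong₂; subst; module ≡-Reasoning)
open import Relation.Nullary using (¬_; ¬?; does; yes; no; contradiction)
open import Relation.Nullary.Decidable using (dec-true)
open import Relation.Unary using (Pred; Decidable)

∣p∪q∣+∣p∩q∣≡∣p∣+∣q∣ : ∀ {n} (p q : Subset n) → ∣ p ∪ q ∣ + ∣ p ∩ q ∣ ≡ ∣ p ∣ + ∣ q ∣
∣p∪q∣+∣p∩q∣≡∣p∣+∣q∣ []            []            = refl
∣p∪q∣+∣p∩q∣≡∣p∣+∣q∣ (inside  ∷ p) (inside  ∷ q) =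
  cong suc (trans (+-suc _ _) (trans (cong suc (∣p∪q∣+∣p∩q∣≡∣p∣+∣q∣ p q)) (sym (+-suc _ _))))
∣p∪q∣+∣p∩q∣≡∣p∣+∣q∣ (inside  ∷ p) (outside ∷ q) = cong suc (∣p∪q∣+∣p∩q∣≡∣p∣+∣q∣ p q)
∣p∪q∣+∣p∩q∣≡∣p∣+∣q∣ (outside ∷ p) (inside  ∷ q) =
  trans (cong suc (∣p∪q∣+∣p∩q∣≡∣p∣+∣q∣ p q)) (sym (+-suc _ _))
∣p∪q∣+∣p∩q∣≡∣p∣+∣q∣ (outside ∷ p) (outside ∷ q) = ∣p∪q∣+∣p∩q∣≡∣p∣+∣q∣ p q

∣p∪q∣≤∣p∣+∣q∣ : ∀ {n} (p q : Subset n) → ∣ p ∪ q ∣ ≤ ∣ p ∣ + ∣ q ∣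
∣p∪q∣≤∣p∣+∣q∣ p q = subst (∣ p ∪ q ∣ ≤_) (∣p∪q∣+∣p∩q∣≡∣p∣+∣q∣ p q) (m≤m+n _ _)

Empty[p∩q]⇒∣p∣+∣q∣≡∣p∪q∣ : ∀ {n} {p q : Subset n} → Empty (p ∩ q) → ∣ p ∣ + ∣ q ∣ ≡ ∣ p ∪ q ∣
Empty[p∩q]⇒∣p∣+∣q∣≡∣p∪q∣ {n} {p} {q} p∩q=∅ = begin
  ∣ p ∣ + ∣ q ∣          ≡⟨ sym (∣p∪q∣+∣p∩q∣≡∣p∣+∣q∣ p q) ⟩
  ∣ p ∪ q ∣ + ∣ p ∩ q ∣  ≡⟨ cong (λ r → ∣ p ∪ q ∣ + ∣ r ∣) (Empty-unique p∩q=∅) ⟩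
  ∣ p ∪ q ∣ + ∣ ∅ {n} ∣  ≡⟨ cong (∣ p ∪ q ∣ +_) (∣⊥∣≡0 n) ⟩
  ∣ p ∪ q ∣ + 0          ≡⟨ +-identityʳ _ ⟩
  ∣ p ∪ q ∣              ∎
  where open ≡-Reasoning

length-filter-tabulate : ∀ {a p n} {A : Set a} {P : Pred A p} (P? : Decidable P) (g : Fin n → A) →
  length (filter P? (List.tabulate g)) ≡ ∣ Vec.tabulate (does ∘ P? ∘ g) ∣
length-filter-tabulate {n = 0}     P? g = refl
length-filter-tabulate {n = suc n} P? g with does (P? (g zero))
... | true  = cong suc (length-filter-tabulate P? (g ∘ suc))
... | false = length-filter-tabulate P? (g ∘ suc)

∈⇒≤maxList : ∀ {k xs} → k ∈ˡ xs → k ≤ maxList xs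
∈⇒≤maxList              (here refl)  = m≤m⊔n _ _
∈⇒≤maxList {xs = x ∷ _} (there k∈xs) = ≤-trans (∈⇒≤maxList k∈xs) (m≤n⊔m x _)

maxList-lub : ∀ {c xs} → All (_≤ c) xs → maxList xs ≤ c
maxList-lub []           = z≤n
maxList-lub (x≤c ∷ xs≤c) = ⊔-lub x≤c (maxList-lub xs≤c)

∈⇒T-lookup : ∀ {n} {p : Subset n} {j} → j ∈ p → T (lookup p j)
∈⇒T-lookup j∈p = Equivalence.from T-≡ ([]=⇒lookup j∈p)

T-lookup⇒∈ : ∀ {n} (p : Subset n) j → T (lookup p j) → j ∈ p
T-lookup⇒∈ p j t = lookup⇒[]= j p (Equivalence.to T-≡ t)

∈∁⇔T-not-lookup : ∀ {n} {x : Subset n} {j} → j ∈ ∁ x ⇔ T (not (lookup x j))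
∈∁⇔T-not-lookup {x = x} {j} = mk⇔
  (λ j∈∁x → subst T (lookup-map j not x) (∈⇒T-lookup j∈∁x))
  (λ t → T-lookup⇒∈ (∁ x) j (subst T (sym (lookup-map j not x)) t))

∈-allPoints : ∀ {n} (x : Point n) → x ∈ˡ allPoints n
∈-allPoints []          = here refl
∈-allPoints (false ∷ x) = ∈-++⁺ˡ (∈-map⁺ (false ∷_) (∈-allPoints x))
∈-allPoints (true  ∷ x) = ∈-++⁺ʳ _ (∈-map⁺ (true ∷_) (∈-allPoints x))

flip-involutive : ∀ {n} (x : Point n) k → flip (flip x k) k ≡ x
flip-involutive x k =
  trans (updateAt-updateAt k x) (updateAt-id-local k x (not-involutive (lookup x k)))

∈-flip⁻ : ∀ {n} {x : Point n} {j k} → j ≢ k → j ∈ flip x k → j ∈ x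
∈-flip⁻ {x = x} {j} {k} j≢k j∈xᵏ =
  subst (j ∈_) (flip-involutive x k) (updateAt-minimal j k (flip x k) j≢k j∈xᵏ)

∉-flip : ∀ {n} {x : Point n} {k} → k ∈ x → k ∉ flip x k
∉-flip {x = x} {k} k∈x k∈xᵏ with () ← []=-injective (updateAt-updates k x k∈x) k∈xᵏ

∈-flip : ∀ {n} {x : Point n} {k} → k ∉ x → k ∈ flip x k
∈-flip {x = x} {k} k∉x with lookup x k in eq
... | true  = contradiction (lookup⇒[]= k x eq) k∉x
... | false = updateAt-updates k x (lookup⇒[]= k x eq)

flip-∅ : ∀ {n} (k : Fin n) → flip ∅ k ≡ ⁅ k ⁆
flip-∅ zero    = refl
flip-∅ (suc k) = cong (outside ∷_) (flip-∅ k)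

-- Points are identified with the subsets of coordinates set to 1.
Satisfies : ∀ {n} → Term n → Point n → Set
Satisfies t x = pos t ⊆ x × neg t ⊆ ∁ x

T-not-∨ : ∀ {a b} → T (not a ∨ b) ⇔ (T a → T b)
T-not-∨ {true}  = mk⇔ (λ tb _ → tb) (λ f → f _)
T-not-∨ {false} = mk⇔ (λ _ ()) (λ _ → _)

satTerm⁻ : ∀ {n} {t : Term n} {x} → T (satTerm t x) → Satisfies t x
satTerm⁻ {t = t} {x} s =
    (λ {j} j∈A → T-lookup⇒∈ x j (Equivalence.to T-not-∨ (proj₁ (literal j)) (∈⇒T-lookup j∈A)))
  , (λ {j} j∈Ā → Equivalence.from ∈∁⇔T-not-lookup
                   (Equivalence.to T-not-∨ (proj₂ (literal j)) (∈⇒T-lookup j∈Ā)))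
  where literal = λ j → Equivalence.to T-∧ (All.lookup (all⁺ _ _ s) (∈-allFin j))

satTerm⁺ : ∀ {n} {t : Term n} {x} → Satisfies t x → T (satTerm t x)
satTerm⁺ {t = t} (A⊆x , Ā⊆∁x) = all⁻ _ (tabulate⁺ λ j → Equivalence.from T-∧
  ( Equivalence.from T-not-∨ (∈⇒T-lookup ∘ A⊆x ∘ T-lookup⇒∈ (pos t) j)
  , Equivalence.from T-not-∨ (Equivalence.to ∈∁⇔T-not-lookup ∘ Ā⊆∁x ∘ T-lookup⇒∈ (neg t) j)))

evalDNF⁺ : ∀ {n m} (D : DNF n m) {x} j → Satisfies (D j) x → T (evalDNF D x)
evalDNF⁺ D {x} j sat = any⁺ (λ i → satTerm (D i) x) (lose (∈-allFin j) (satTerm⁺ sat))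

evalDNF⁻ : ∀ {n m} (D : DNF n m) {x} → T (evalDNF D x) → ∃[ j ] Satisfies (D j) x
evalDNF⁻ {m = m} D {x} t with find (any⁻ (λ i → satTerm (D i) x) (allFin m) t)
... | j , _ , sat = j , satTerm⁻ sat

satisfies-⁅⁆ : ∀ {n} {t : Term n} {k} → Empty (pos t ∩ neg t) → k ∈ pos t → pos t ⊆ ⁅ k ⁆ →
  Satisfies t ⁅ k ⁆
satisfies-⁅⁆ {t = t} {k} A∩Ā=∅ k∈A A⊆⁅k⁆ = A⊆⁅k⁆ , λ {l} l∈Ā → x∉p⇒x∈∁p λ l∈⁅k⁆ →
  A∩Ā=∅ (k , x∈p∩q⁺ (k∈A , subst (_∈ neg t) (x∈⁅y⁆⇒x≡y k l∈⁅k⁆) l∈Ā))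

nonempty⊆⁅x⁆⇒x∈p : ∀ {n} {p : Subset n} {x} → Nonempty p → p ⊆ ⁅ x ⁆ → x ∈ p
nonempty⊆⁅x⁆⇒x∈p {p = p} (y , y∈p) p⊆⁅x⁆ = subst (_∈ p) (x∈⁅y⁆⇒x≡y _ (p⊆⁅x⁆ y∈p)) y∈p

sensitiveSet : ∀ {n} → BoolFun n → Point n → Subset n
sensitiveSet f x = Vec.tabulate λ k → does (¬? (f x ≟B f (flip x k)))

sensAt≡∣sensitiveSet∣ : ∀ {n} (f : BoolFun n) x → sensAt f x ≡ ∣ sensitiveSet f x ∣
sensAt≡∣sensitiveSet∣ f x = length-filter-tabulate (λ k → ¬? (f x ≟B f (flip x k))) id

∈-sensitiveSet : ∀ {n} (f : BoolFun n) x {k} → f x ≢ f (flip x k) → k ∈ sensitiveSet f x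
∈-sensitiveSet f x {k} fx≢fxᵏ =
  lookup⇒[]= k _ (trans (lookup∘tabulate _ k) (dec-true (¬? (f x ≟B f (flip x k))) fx≢fxᵏ))

sensAt≤sens : ∀ {n} (f : BoolFun n) x → sensAt f x ≤ sens f
sensAt≤sens f x = ∈⇒≤maxList (∈-map⁺ (sensAt f) (∈-allPoints x))

T-≢ : ∀ {a b} → T a → ¬ T b → a ≢ b
T-≢ ta ¬tb refl = ¬tb ta

pos-nonempty : ∀ {n m} (D : DNF n m) → ¬ T (evalDNF D ∅) → ∀ j → Nonempty (pos (D j))
pos-nonempty D f∅ j with nonempty? (pos (D j))
... | yes A≠∅ = A≠∅
... | no  A=∅ = contradiction
  (evalDNF⁺ D j ((λ {l} l∈A → contradiction (l , l∈A) A=∅) , λ _ → x∉p⇒x∈∁p ∉⊥)) f∅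

pos⊆⁅⁆-at-flip : ∀ {n m} (D : DNF n m) → BlockProperty D → ∀ {i j k} → j ≢ i →
  Satisfies (D j) (flip (pos (D i)) k) → pos (D j) ⊆ ⁅ k ⁆
pos⊆⁅⁆-at-flip D bp {i} {j} {k} j≢i (Aⱼ⊆x , _) {l} l∈Aⱼ with l ≟F k
... | yes refl = x∈⁅x⁆ l
... | no  l≢k  = contradiction (l , x∈p∩q⁺ (l∈Aⱼ , ∈-flip⁻ l≢k (Aⱼ⊆x l∈Aⱼ))) (bp j i j≢i)

module _ {n m} (D : DNF n m) (wf : WellFormed D) (bp : BlockProperty D)
         (f∅ : ¬ T (evalDNF D ∅)) (i : Fin m) where

  private
    f = evalDNF D
    A = pos (D i)
    Ā = neg (D i)

  evalDNF-pos : T (f A)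
  evalDNF-pos =
    evalDNF⁺ D i (id , λ {l} l∈Ā → x∉p⇒x∈∁p λ l∈A → wf i (l , x∈p∩q⁺ (l∈A , l∈Ā)))

  evalDNF-flip-pos : ∀ {k} → k ∈ A → ¬ T (f (flip A k))
  evalDNF-flip-pos {k} k∈A t with evalDNF⁻ D t
  ... | j , sat with j ≟F i
  ...   | yes refl = ∉-flip k∈A (proj₁ sat k∈A)
  ...   | no  j≢i  = bp j i j≢i (k , x∈p∩q⁺ (k∈Aⱼ , k∈A))
    where k∈Aⱼ = nonempty⊆⁅x⁆⇒x∈p (pos-nonempty D f∅ j) (pos⊆⁅⁆-at-flip D bp j≢i sat)

  evalDNF-flip-neg : ∀ {k} → k ∈ Ā → T (f (flip A k)) → T (f (flip ∅ k))
  evalDNF-flip-neg {k} k∈Ā t with evalDNF⁻ D t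
  ... | j , sat with j ≟F i
  ...   | yes refl = ⊥-elim (x∈∁p⇒x∉p (proj₂ sat k∈Ā) (∈-flip λ k∈A → wf i (k , x∈p∩q⁺ (k∈A , k∈Ā))))
  ...   | no  j≢i  = subst (T ∘ f) (sym (flip-∅ k))
    (evalDNF⁺ D j (satisfies-⁅⁆ (wf j) (nonempty⊆⁅x⁆⇒x∈p (pos-nonempty D f∅ j) Aⱼ⊆⁅k⁆) Aⱼ⊆⁅k⁆))
    where Aⱼ⊆⁅k⁆ = pos⊆⁅⁆-at-flip D bp j≢i sat

  pos⊆sensitiveSet : A ⊆ sensitiveSet f A
  pos⊆sensitiveSet k∈A = ∈-sensitiveSet f A (T-≢ evalDNF-pos (evalDNF-flip-pos k∈A))

  neg⊆sensitiveSet : Ā ⊆ sensitiveSet f A ∪ sensitiveSet f ∅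
  neg⊆sensitiveSet {k} k∈Ā with T? (f (flip A k))
  ... | yes t = x∈p∪q⁺ (inj₂ (∈-sensitiveSet f ∅ (T-≢ (evalDNF-flip-neg k∈Ā t) f∅ ∘ sym)))
  ... | no ¬t = x∈p∪q⁺ (inj₁ (∈-sensitiveSet f A (T-≢ evalDNF-pos ¬t)))

  term-size≤sens+sens : ∣ A ∣ + ∣ Ā ∣ ≤ sens f + sens f
  term-size≤sens+sens = begin
    ∣ A ∣ + ∣ Ā ∣            ≡⟨ Empty[p∩q]⇒∣p∣+∣q∣≡∣p∪q∣ (wf i) ⟩
    ∣ A ∪ Ā ∣                ≤⟨ p⊆q⇒∣p∣≤∣q∣ A∪Ā⊆Sₐ∪S∅ ⟩
    ∣ Sₐ ∪ S∅ ∣              ≤⟨ ∣p∪q∣≤∣p∣+∣q∣ Sₐ S∅ ⟩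
    ∣ Sₐ ∣ + ∣ S∅ ∣          ≡⟨ sym (cong₂ _+_ (sensAt≡∣sensitiveSet∣ f A) (sensAt≡∣sensitiveSet∣ f ∅)) ⟩
    sensAt f A + sensAt f ∅  ≤⟨ +-mono-≤ (sensAt≤sens f A) (sensAt≤sens f ∅) ⟩
    sens f + sens f          ∎
    where
    open ≤-Reasoning
    Sₐ = sensitiveSet f A
    S∅ = sensitiveSet f ∅
    A∪Ā⊆Sₐ∪S∅ : A ∪ Ā ⊆ Sₐ ∪ S∅
    A∪Ā⊆Sₐ∪S∅ {k} k∈A∪Ā with x∈p∪q⁻ A Ā k∈A∪Ā
    ... | inj₁ k∈A = x∈p∪q⁺ (inj₁ (pos⊆sensitiveSet k∈A))
    ... | inj₂ k∈Ā = neg⊆sensitiveSet k∈Ā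

lemma6 : ∀ {n m : ℕ} (D : DNF n m) → WellFormed D → CompactForm D → BlockProperty D →
    ⌈ width D /2⌉ ≤ sens (evalDNF D)
lemma6 {m = m} D wf cf bp = subst (⌈ width D /2⌉ ≤_) (sym (n≡⌈n+n/2⌉ _))
  (⌈n/2⌉-mono (maxList-lub (map⁺ (tabulate⁺ {n = m} (term-size≤sens+sens D wf bp f∅)))))
  where
  f∅ : ¬ T (evalDNF D (zeroPt _))
  f∅ = subst T (CompactForm.zeroIsZero cf)
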